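{- For every integer $n>2$, \[ \overline{\mathrm{spt}}1_o(n)+\overline{\mathrm{spt}}1_o(n-2)=2\,\overline{p}_e(n-1)+\overline{p}_{oex}(n-1). \]
   Context: An overpartition of $n$ is a partition of $n$ in which the first occurrence of each distinct part size may be overlined. For an overpartition $\pi$, $s(\pi)$ denotes its smallest non-overlined part. $\overline{\mathrm{spt}}1_o(n)$ is the number of overpartitions $\pi$ of $n$ having at least one non-overlined part, such that $s(\pi)$ appears exactly once, every overlined part is strictly bigger than $s(\pi)$, and every part other than $s(\pi)$ has parity different from that of $s(\pi)$. $\overline{p}_e(m)$ is the number of overpartitions of $m$ all of whose parts are even; $\overline{p}_{oex}(m)$ is the number of overpartitions of $m$ all of whose parts are odd and which contain no non-overlined part equal to $1$. -}

module Defs where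

open import Data.Nat using (ℕ; zero; suc; _+_; _%_; _≡ᵇ_; _<ᵇ_; _≤ᵇ_)
open import Data.Bool using (Bool; true; false; _∧_; not)
open import Data.List using (List; []; _∷_; _++_; length; filterᵇ; map; concatMap; reverse; upTo)
open import Data.Nat.ListAction using (sum)
open import Data.Product using (_×_; _,_)

-- An overpartition is represented (standard bijection) by a pair
--   (ov , nov)
-- where ov is the list of overlined parts (distinct, hence written strictly
-- decreasing) and nov is the list of non-overlined parts (written weakly
-- decreasing).  A part size may occur both
-- overlined (its first occurrence) and non-overlined (further occurrences).
-- every element of the list satisfies the boolean predicate
allL : {A : Set} → (A → Bool) → List A → Bool
allL p [] = true
allL p (x ∷ xs) = p x ∧ allL p xs

Overpartition : Set
Overpartition = List ℕ × List ℕ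

strictDec : List ℕ → Bool
strictDec [] = true
strictDec (x ∷ []) = true
strictDec (x ∷ y ∷ xs) = (y <ᵇ x) ∧ strictDec (y ∷ xs)

nonInc : List ℕ → Bool
nonInc [] = true
nonInc (x ∷ []) = true
nonInc (x ∷ y ∷ xs) = (y ≤ᵇ x) ∧ nonInc (y ∷ xs)

parts : Overpartition → List ℕ
parts (ov , nov) = ov ++ nov

isOverpartitionOf : ℕ → Overpartition → Bool
isOverpartitionOf n (ov , nov) =
  strictDec ov ∧ nonInc nov ∧ allL (λ p → 1 ≤ᵇ p) (ov ++ nov)
  ∧ (sum ov + sum nov ≡ᵇ n)

listsOfLen : ℕ → ℕ → List (List ℕ)
listsOfLen zero n = [] ∷ []
listsOfLen (suc k) n =
  concatMap (λ xs → map (λ i → suc i ∷ xs) (upTo n)) (listsOfLen k n)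

smallLists : ℕ → List (List ℕ)
smallLists n = concatMap (λ k → listsOfLen k n) (upTo (suc n))

-- a finite, duplicate-free list of candidates containing every overpartition of n
candidates : ℕ → List Overpartition
candidates n = concatMap (λ ov → map (λ nov → (ov , nov)) (smallLists n)) (smallLists n)

countOP : (Overpartition → Bool) → ℕ → ℕ
countOP P n = length (filterᵇ (λ π → isOverpartitionOf n π ∧ P π) (candidates n))

parity : ℕ → ℕ
parity k = k % 2

_≠ᵇ_ : ℕ → ℕ → Bool
a ≠ᵇ b = not (a ≡ᵇ b)

occurrences : ℕ → List ℕ → ℕ
occurrences s xs = length (filterᵇ (λ p → p ≡ᵇ s) xs)

-- The spt1_o condition.  Since nov is weakly decreasing, its last element is
-- the smallest non-overlined part s(π); "rest" are the other non-overlined parts.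
spt1oCond : Overpartition → Bool
spt1oCond (ov , nov) with reverse nov
... | [] = false
... | s ∷ rest =
      (occurrences s (ov ++ nov) ≡ᵇ 1)
      ∧ allL (λ p → s <ᵇ p) ov
      ∧ allL (λ p → parity p ≠ᵇ parity s) (ov ++ rest)

allEven : Overpartition → Bool
allEven π = allL (λ p → parity p ≡ᵇ 0) (parts π)

allOddNoPlain1 : Overpartition → Bool
allOddNoPlain1 (ov , nov) =
  allL (λ p → parity p ≡ᵇ 1) (ov ++ nov) ∧ allL (λ p → 1 <ᵇ p) nov

spt1o : ℕ → ℕ
spt1o = countOP spt1oCond

pbar-e : ℕ → ℕ
pbar-e = countOP allEven

pbar-oex : ℕ → ℕ
pbar-oex = countOP allOddNoPlain1

{-# OPTIONS --safe #-}
module Submission where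

-- Deleting the part s = s(π) maps the overpartitions counted by spt1o n with s(π) = s
-- bijectively onto the overpartitions of n ∸ s whose parts all exceed s and have the
-- parity opposite to s; call their number pbar-opp s (n ∸ s).  Asking whether the least
-- such part, s + 1, occurs plain, only overlined, or not at all gives
--   pbar-opp s (s + 1 + y) = pbar-opp (s + 2) (s + 1 + y) + pbar-opp (s + 2) y + pbar-opp s y.
-- Taking s + 1 + y = L + 1, the two terms evaluated at y are the s + 2 term of
-- spt1o (L + 2) and the s term of spt1o L, so summing over s ≥ 1 telescopes in steps
-- of two and leaves
--   spt1o (L + 2) + spt1o L = 2 pbar-opp 1 (L + 1) + pbar-opp 2 (L + 1) + pbar-opp 2 L.
-- Here pbar-opp 1 counts overpartitions into even parts, and the same case distinction,
-- applied to odd parts and the part 1, shows that the last two terms add up to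
-- pbar-oex (L + 1).  Counts are lengths of duplicate-free enumerations, so every
-- bijection yields an equality of counts through bag equality.

open import Defs
open import Data.Nat using (ℕ; zero; suc; _+_; _∸_; _*_; _<_; _≤_; _>_; _≥_; z≤n; s≤s; _≡ᵇ_; _<ᵇ_; _≤ᵇ_; _≤?_)
open import Data.Nat.Properties
open import Data.Nat.DivMod using ([m+n]%n≡m%n)
open import Data.Nat.ListAction using (sum)
open import Data.Nat.ListAction.Properties using (sum-++)
open import Data.Nat.Tactic.RingSolver using (solve-∀)
open import Data.Bool using (Bool; true; false; _∧_; not; T; T?)
open import Data.Bool.Properties using (T-∧)
open import Data.List
  using (List; []; _∷_; _++_; [_]; _∷ʳ_; initLast; _∷ʳ′_; length; map; concatMap; filterᵇ; upTo; reverse;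
         cartesianProductWith; cartesianProduct)
open import Data.List.Properties
  using (length-map; filter-none; filter-accept; filter-++; ∷ʳ-injectiveˡ; ++-assoc; reverse-++)
open import Data.List.Membership.Propositional using (_∈_)
open import Data.List.Membership.Propositional.Properties
  using (∈-++⁺ʳ; ∈-map⁺; ∈-map⁻; ∈-filter⁺; ∈-filter⁻; ∈-concat⁺′; ∈-upTo⁺;
         ∈-cartesianProductWith⁺; ∈-cartesianProductWith⁻; ∈-cartesianProduct⁺)
open import Data.List.Membership.Propositional.Properties.WithK using (unique∧set⇒bag)
open import Data.List.Relation.Binary.BagAndSetEquality using (∼bag⇒↭)
open import Data.List.Relation.Binary.Permutation.Propositional using (_↭_; ↭-sym)
open import Data.List.Relation.Binary.Permutation.Propositional.Properties
  using (↭-length; ↭-reverse; ++⁺ˡ; All-resp-↭)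
open import Data.List.Relation.Unary.All as All using (All; []; _∷_)
import Data.List.Relation.Unary.All.Properties as All
import Data.List.Relation.Unary.AllPairs as AllPairs
import Data.List.Relation.Unary.AllPairs.Properties as AllPairs
open import Data.List.Relation.Unary.Any using (here; there)
open import Data.List.Relation.Unary.Linked as Linked using (Linked; []; [-]; _∷_)
open import Data.List.Relation.Unary.Unique.Propositional using (Unique)
import Data.List.Relation.Unary.Unique.Propositional.Properties as Unique
open import Data.Product using (∃-syntax; _×_; _,_; proj₁; proj₂)
open import Data.Sum using (_⊎_; inj₁; inj₂)
open import Data.Empty using (⊥-elim)
open import Function using (_∘_; _⇔_; mk⇔; Equivalence; case_of_)
open import Relation.Nullary using (¬_; yes; no)
open import Relation.Binary.PropositionalEquality hiding ([_])

open Equivalence using (to; from)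

T-not : ∀ {b} → T (not b) ⇔ (¬ T b)
T-not {false} = mk⇔ (λ _ ()) (λ _ → _)
T-not {true}  = mk⇔ (λ ()) (λ ¬t → ¬t _)

T-≠ᵇ : ∀ {a b} → T (a ≠ᵇ b) ⇔ a ≢ b
T-≠ᵇ {a} {b} = mk⇔ (λ t a≡b → T-not .to t (≡⇒≡ᵇ a b a≡b)) (λ a≢b → T-not .from (a≢b ∘ ≡ᵇ⇒≡ a b))

T-allL : ∀ {p : ℕ → Bool} xs → T (allL p xs) ⇔ All (T ∘ p) xs
T-allL _ = mk⇔ to′ from′
  where
  to′ : ∀ {p : ℕ → Bool} {xs} → T (allL p xs) → All (T ∘ p) xs
  to′ {xs = []}     _ = []
  to′ {xs = x ∷ xs} t = let px , pxs = T-∧ .to t in px ∷ to′ pxs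
  from′ : ∀ {p : ℕ → Bool} {xs} → All (T ∘ p) xs → T (allL p xs)
  from′ []         = _
  from′ (px ∷ pxs) = T-∧ .from (px , from′ pxs)

T-allAbove : ∀ {m} xs → T (allL (m <ᵇ_) xs) ⇔ All (m <_) xs
T-allAbove xs = mk⇔ (All.map (<ᵇ⇒< _ _) ∘ T-allL xs .to) (T-allL xs .from ∘ All.map <⇒<ᵇ)

T-strictDec : ∀ {xs} → T (strictDec xs) ⇔ Linked _>_ xs
T-strictDec = mk⇔ to′ from′
  where
  to′ : ∀ {xs} → T (strictDec xs) → Linked _>_ xs
  to′ {[]}         _ = []
  to′ {x ∷ []}     _ = [-]
  to′ {x ∷ y ∷ xs} t = let y<x , rest = T-∧ .to t in <ᵇ⇒< y x y<x ∷ to′ rest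
  from′ : ∀ {xs} → Linked _>_ xs → T (strictDec xs)
  from′ []           = _
  from′ [-]          = _
  from′ (y<x ∷ rest) = T-∧ .from (<⇒<ᵇ y<x , from′ rest)

T-nonInc : ∀ {xs} → T (nonInc xs) ⇔ Linked _≥_ xs
T-nonInc = mk⇔ to′ from′
  where
  to′ : ∀ {xs} → T (nonInc xs) → Linked _≥_ xs
  to′ {[]}         _ = []
  to′ {x ∷ []}     _ = [-]
  to′ {x ∷ y ∷ xs} t = let y≤x , rest = T-∧ .to t in ≤ᵇ⇒≤ y x y≤x ∷ to′ rest
  from′ : ∀ {xs} → Linked _≥_ xs → T (nonInc xs)
  from′ []           = _
  from′ [-]          = _
  from′ (y≤x ∷ rest) = T-∧ .from (≤⇒≤ᵇ y≤x , from′ rest)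

length≤sum : ∀ {xs} → All (1 ≤_) xs → length xs ≤ sum xs
length≤sum []               = z≤n
length≤sum (1≤x ∷ positive) = +-mono-≤ 1≤x (length≤sum positive)

All-≤-sum : ∀ xs → All (_≤ sum xs) xs
All-≤-sum []       = []
All-≤-sum (x ∷ xs) = m≤m+n x (sum xs) ∷ All.map (m≤n⇒m≤o+n x) (All-≤-sum xs)

All>⇒sum≡⇒≡0 : ∀ {x} xs → All (x <_) xs → sum xs ≡ x → x ≡ 0
All>⇒sum≡⇒≡0 []       _         sum≡x = sym sum≡x
All>⇒sum≡⇒≡0 (p ∷ ps) (x<p ∷ _) sum≡x = ⊥-elim (<⇒≱ x<p (subst (p ≤_) sum≡x (m≤m+n p (sum ps))))

sum-∷ʳ : ∀ xs m → sum (xs ∷ʳ m) ≡ sum xs + m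
sum-∷ʳ xs m = trans (sum-++ xs [ m ]) (cong (sum xs +_) (+-identityʳ m))

Linked-∷ʳ⁺ : ∀ {R : ℕ → ℕ → Set} {xs m} → Linked R xs → All (λ x → R x m) xs → Linked R (xs ∷ʳ m)
Linked-∷ʳ⁺ []      []       = [-]
Linked-∷ʳ⁺ [-]     (r ∷ []) = r ∷ [-]
Linked-∷ʳ⁺ (r ∷ l) (_ ∷ rs) = r ∷ Linked-∷ʳ⁺ l rs

Linked-∷ʳ⁻ : ∀ {R : ℕ → ℕ → Set} {m} xs → Linked R (xs ∷ʳ m) → Linked R xs
Linked-∷ʳ⁻ []           _       = []
Linked-∷ʳ⁻ (x ∷ [])     _       = [-]
Linked-∷ʳ⁻ (x ∷ y ∷ xs) (r ∷ l) = r ∷ Linked-∷ʳ⁻ (y ∷ xs) l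

Linked-∷ʳ⇒All : ∀ {R : ℕ → ℕ → Set} {m} → (∀ {a b c} → R a b → R b c → R a c) →
  ∀ xs → Linked R (xs ∷ʳ m) → All (λ x → R x m) xs
Linked-∷ʳ⇒All R-trans []           _         = []
Linked-∷ʳ⇒All R-trans (x ∷ [])     (r ∷ [-]) = r ∷ []
Linked-∷ʳ⇒All R-trans (x ∷ y ∷ xs) (r ∷ l)   with Linked-∷ʳ⇒All R-trans (y ∷ xs) l
... | r′ ∷ rs = R-trans r r′ ∷ r′ ∷ rs

Linked-≥-last : ∀ {xs m} → Linked _≥_ xs → m ∈ xs → All (m ≤_) xs → ∃[ ys ] xs ≡ ys ∷ʳ m
Linked-≥-last {x ∷ []}     _         (here refl) _ = [] , refl
Linked-≥-last {x ∷ y ∷ xs} (y≤x ∷ l) (here refl) (_ ∷ x≤y ∷ bounds)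
  with ys , eq ← Linked-≥-last l (here (≤-antisym x≤y y≤x)) (x≤y ∷ bounds) = x ∷ ys , cong (x ∷_) eq
Linked-≥-last {x ∷ y ∷ xs} (_ ∷ l)   (there m∈)  (_ ∷ bounds)
  with ys , eq ← Linked-≥-last l m∈ bounds = x ∷ ys , cong (x ∷_) eq

¬allAbove⇒∈ : ∀ {m xs} → All (m ≤_) xs → ¬ T (allL (m <ᵇ_) xs) → m ∈ xs
¬allAbove⇒∈ {xs = []}     []             ¬above = ⊥-elim (¬above _)
¬allAbove⇒∈ {m} {x ∷ xs} (m≤x ∷ bounds) ¬above with m ≟ x
... | yes refl = here refl
... | no  m≢x  = there (¬allAbove⇒∈ bounds λ above → ¬above (T-∧ .from (<⇒<ᵇ (≤∧≢⇒< m≤x m≢x) , above)))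

¬allAbove-∷ʳ : ∀ {m} xs → ¬ T (allL (m <ᵇ_) (xs ∷ʳ m))
¬allAbove-∷ʳ {m} xs above = n≮n m (proj₂ (All.∷ʳ⁻ (T-allAbove (xs ∷ʳ m) .to above)))

occurrences-∷ʳ : ∀ {s} xs → All (_≢ s) xs → occurrences s (xs ∷ʳ s) ≡ 1
occurrences-∷ʳ {s} xs xs≢s = cong length (begin
  filterᵇ (_≡ᵇ s) (xs ++ [ s ])               ≡⟨ filter-++ is-s? xs [ s ] ⟩
  filterᵇ (_≡ᵇ s) xs ++ filterᵇ (_≡ᵇ s) [ s ] ≡⟨ cong₂ _++_ (filter-none is-s? (All.map (λ p≢s → p≢s ∘ ≡ᵇ⇒≡ _ s) xs≢s))
                                                             (filter-accept is-s? (≡⇒≡ᵇ s s refl)) ⟩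
  [ s ]                                       ∎)
  where
  open ≡-Reasoning
  is-s? = T? ∘ (_≡ᵇ s)

-- Enumeration of the candidates

concatMap-map≡cartesianProductWith : ∀ {A B C : Set} (f : A → B → C) xs ys →
  concatMap (λ x → map (f x) ys) xs ≡ cartesianProductWith f xs ys
concatMap-map≡cartesianProductWith f []       ys = refl
concatMap-map≡cartesianProductWith f (x ∷ xs) ys =
  cong (map (f x) ys ++_) (concatMap-map≡cartesianProductWith f xs ys)

prepend : List ℕ → ℕ → List ℕ
prepend xs i = suc i ∷ xs

listsOfLen-suc : ∀ k n → listsOfLen (suc k) n ≡ cartesianProductWith prepend (listsOfLen k n) (upTo n)
listsOfLen-suc k n = concatMap-map≡cartesianProductWith prepend (listsOfLen k n) (upTo n)

length-listsOfLen : ∀ k n {xs} → xs ∈ listsOfLen k n → length xs ≡ k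
length-listsOfLen zero    n (here refl) = refl
length-listsOfLen (suc k) n xs∈ rewrite listsOfLen-suc k n
  with ys , i , ys∈ , _ , refl ← ∈-cartesianProductWith⁻ prepend (listsOfLen k n) (upTo n) xs∈ =
  cong suc (length-listsOfLen k n ys∈)

listsOfLen-unique : ∀ k n → Unique (listsOfLen k n)
listsOfLen-unique zero    n = [] AllPairs.∷ AllPairs.[]
listsOfLen-unique (suc k) n rewrite listsOfLen-suc k n =
  Unique.cartesianProductWith⁺ prepend (λ { refl → refl , refl }) (listsOfLen-unique k n) (Unique.upTo⁺ n)

∈-listsOfLen : ∀ {n} xs → All (λ p → 1 ≤ p × p ≤ n) xs → xs ∈ listsOfLen (length xs) n
∈-listsOfLen     []           []                  = here refl
∈-listsOfLen {n} (suc i ∷ xs) ((_ , i<n) ∷ bounded) rewrite listsOfLen-suc (length xs) n =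
  ∈-cartesianProductWith⁺ prepend (∈-listsOfLen xs bounded) (∈-upTo⁺ i<n)

smallLists-unique : ∀ n → Unique (smallLists n)
smallLists-unique n =
  Unique.concat⁺ (All.map⁺ (All.universal (λ k → listsOfLen-unique k n) (upTo (suc n))))
                 (AllPairs.map⁺ (AllPairs.map disjoint (Unique.upTo⁺ (suc n))))
  where
  disjoint : ∀ {i j} → i ≢ j → ∀ {xs} → ¬ (xs ∈ listsOfLen i n × xs ∈ listsOfLen j n)
  disjoint i≢j (xs∈ᵢ , xs∈ⱼ) = i≢j (trans (sym (length-listsOfLen _ n xs∈ᵢ)) (length-listsOfLen _ n xs∈ⱼ))

∈-smallLists : ∀ {n xs} → All (1 ≤_) xs → sum xs ≤ n → xs ∈ smallLists n
∈-smallLists {n} {xs} positive sum≤n =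
  ∈-concat⁺′ (∈-listsOfLen xs bounded) (∈-map⁺ (λ k → listsOfLen k n) (∈-upTo⁺ (s≤s (≤-trans (length≤sum positive) sum≤n))))
  where
  bounded = All.zipWith (λ (1≤p , p≤sum) → 1≤p , ≤-trans p≤sum sum≤n) (positive , All-≤-sum xs)

candidates≡cartesianProduct : ∀ n → candidates n ≡ cartesianProduct (smallLists n) (smallLists n)
candidates≡cartesianProduct n = concatMap-map≡cartesianProductWith _,_ (smallLists n) (smallLists n)

candidates-unique : ∀ n → Unique (candidates n)
candidates-unique n rewrite candidates≡cartesianProduct n =
  Unique.cartesianProduct⁺ (smallLists-unique n) (smallLists-unique n)

record IsOverpartitionOf (n : ℕ) (π : Overpartition) : Set where
  field
    overlined-decreasing : Linked _>_ (proj₁ π)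
    plain-nonincreasing  : Linked _≥_ (proj₂ π)
    parts-positive       : All (1 ≤_) (parts π)
    parts-sum            : sum (proj₁ π) + sum (proj₂ π) ≡ n

open IsOverpartitionOf

T-isOverpartitionOf : ∀ {n π} → T (isOverpartitionOf n π) ⇔ IsOverpartitionOf n π
T-isOverpartitionOf {n} {π} = mk⇔ to′ from′
  where
  to′ : T (isOverpartitionOf n π) → IsOverpartitionOf n π
  to′ t =
    let sd , t₁ = T-∧ .to t; ni , t₂ = T-∧ .to t₁; pos , eq = T-∧ .to t₂
    in record { overlined-decreasing = T-strictDec .to sd
              ; plain-nonincreasing  = T-nonInc .to ni
              ; parts-positive       = All.map (≤ᵇ⇒≤ 1 _) (T-allL (parts π) .to pos)
              ; parts-sum            = ≡ᵇ⇒≡ _ n eq }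
  from′ : IsOverpartitionOf n π → T (isOverpartitionOf n π)
  from′ v = T-∧ .from (T-strictDec .from (overlined-decreasing v) ,
            T-∧ .from (T-nonInc .from (plain-nonincreasing v) ,
            T-∧ .from (T-allL (parts π) .from (All.map ≤⇒≤ᵇ (parts-positive v)) ,
                       ≡⇒≡ᵇ _ n (parts-sum v))))

sum-parts : ∀ {n π} → IsOverpartitionOf n π → sum (parts π) ≡ n
sum-parts {π = ov , nov} v = trans (sum-++ ov nov) (parts-sum v)

parts≤n : ∀ {n π} → IsOverpartitionOf n π → All (_≤ n) (parts π)
parts≤n {π = π} v = subst (λ k → All (_≤ k) (parts π)) (sum-parts v) (All-≤-sum (parts π))

∈-candidates : ∀ {n π} → IsOverpartitionOf n π → π ∈ candidates n
∈-candidates {n} {ov , nov} v rewrite candidates≡cartesianProduct n =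
  ∈-cartesianProduct⁺ (∈-smallLists (proj₁ positive) (subst (sum ov ≤_) (parts-sum v) (m≤m+n _ _)))
                      (∈-smallLists (proj₂ positive) (subst (sum nov ≤_) (parts-sum v) (m≤n+m _ _)))
  where positive = All.++⁻ ov (parts-positive v)

plain-sum : ∀ ov nov m → sum ov + sum (nov ∷ʳ m) ≡ m + (sum ov + sum nov)
plain-sum ov nov m = trans (cong (sum ov +_) (sum-∷ʳ nov m)) (shuffle (sum ov) (sum nov) m)
  where
  shuffle : ∀ a b m → a + (b + m) ≡ m + (a + b)
  shuffle = solve-∀

overlined-sum : ∀ ov nov m → sum (ov ∷ʳ m) + sum nov ≡ m + (sum ov + sum nov)
overlined-sum ov nov m = trans (cong (_+ sum nov) (sum-∷ʳ ov m)) (shuffle (sum ov) (sum nov) m)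
  where
  shuffle : ∀ a b m → (a + m) + b ≡ m + (a + b)
  shuffle = solve-∀

append-plain : ∀ {y ov nov m} → IsOverpartitionOf y (ov , nov) → 1 ≤ m → All (m ≤_) nov →
  IsOverpartitionOf (m + y) (ov , nov ∷ʳ m)
append-plain {_} {ov} {nov} {m} v 1≤m nov≥m = record
  { overlined-decreasing = overlined-decreasing v
  ; plain-nonincreasing  = Linked-∷ʳ⁺ (plain-nonincreasing v) nov≥m
  ; parts-positive       = let pov , pnov = All.++⁻ ov (parts-positive v) in All.++⁺ pov (All.∷ʳ⁺ pnov 1≤m)
  ; parts-sum            = trans (plain-sum ov nov m) (cong (m +_) (parts-sum v))
  }

remove-plain : ∀ {y ov nov m} → IsOverpartitionOf (m + y) (ov , nov ∷ʳ m) → IsOverpartitionOf y (ov , nov)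
remove-plain {_} {ov} {nov} {m} v = record
  { overlined-decreasing = overlined-decreasing v
  ; plain-nonincreasing  = Linked-∷ʳ⁻ nov (plain-nonincreasing v)
  ; parts-positive       = let pov , pnov = All.++⁻ ov (parts-positive v) in All.++⁺ pov (proj₁ (All.∷ʳ⁻ pnov))
  ; parts-sum            = +-cancelˡ-≡ m _ _ (trans (sym (plain-sum ov nov m)) (parts-sum v))
  }

append-overlined : ∀ {y ov nov m} → IsOverpartitionOf y (ov , nov) → 1 ≤ m → All (m <_) ov →
  IsOverpartitionOf (m + y) (ov ∷ʳ m , nov)
append-overlined {_} {ov} {nov} {m} v 1≤m ov>m = record
  { overlined-decreasing = Linked-∷ʳ⁺ (overlined-decreasing v) ov>m
  ; plain-nonincreasing  = plain-nonincreasing v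
  ; parts-positive       = let pov , pnov = All.++⁻ ov (parts-positive v) in All.++⁺ (All.∷ʳ⁺ pov 1≤m) pnov
  ; parts-sum            = trans (overlined-sum ov nov m) (cong (m +_) (parts-sum v))
  }

remove-overlined : ∀ {y ov nov m} → IsOverpartitionOf (m + y) (ov ∷ʳ m , nov) → IsOverpartitionOf y (ov , nov)
remove-overlined {_} {ov} {nov} {m} v = record
  { overlined-decreasing = Linked-∷ʳ⁻ ov (overlined-decreasing v)
  ; plain-nonincreasing  = plain-nonincreasing v
  ; parts-positive       = let pov , pnov = All.++⁻ (ov ∷ʳ m) (parts-positive v) in All.++⁺ (proj₁ (All.∷ʳ⁻ pov)) pnov
  ; parts-sum            = +-cancelˡ-≡ m _ _ (trans (sym (overlined-sum ov nov m)) (parts-sum v))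
  }

-- Counting by bijections

Good : (Overpartition → Bool) → ℕ → Overpartition → Set
Good P n π = IsOverpartitionOf n π × T (P π)

isGood : (Overpartition → Bool) → ℕ → Overpartition → Bool
isGood P n π = isOverpartitionOf n π ∧ P π

goods : (Overpartition → Bool) → ℕ → List Overpartition
goods P n = filterᵇ (isGood P n) (candidates n)

goods-unique : ∀ P n → Unique (goods P n)
goods-unique P n = Unique.filter⁺ (T? ∘ isGood P n) (candidates-unique n)

∈-goods : ∀ {P n π} → π ∈ goods P n ⇔ Good P n π
∈-goods {P} {n} = mk⇔
  (λ π∈ → let _ , t = ∈-filter⁻ (T? ∘ isGood P n) {xs = candidates n} π∈; v , p = T-∧ .to t
          in T-isOverpartitionOf .to v , p)
  (λ (v , p) → ∈-filter⁺ (T? ∘ isGood P n) (∈-candidates v) (T-∧ .from (T-isOverpartitionOf .from v , p)))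

countOP-bijection : ∀ {P Q m n} (g : Overpartition → Overpartition) →
  (∀ {σ τ} → g σ ≡ g τ → σ ≡ τ) →
  (∀ {σ} → Good Q m σ → Good P n (g σ)) →
  (∀ {π} → Good P n π → ∃[ σ ] Good Q m σ × g σ ≡ π) →
  countOP Q m ≡ countOP P n
countOP-bijection {P} {Q} {m} {n} g g-injective g-good g-onto = begin
  length (goods Q m)         ≡⟨ length-map g (goods Q m) ⟨
  length (map g (goods Q m)) ≡⟨ ↭-length (∼bag⇒↭ (unique∧set⇒bag image-unique (goods-unique P n) same)) ⟩
  length (goods P n)         ∎
  where
  open ≡-Reasoning
  image-unique : Unique (map g (goods Q m))
  image-unique = Unique.map⁺ g-injective (goods-unique Q m)
  same : ∀ {π} → π ∈ map g (goods Q m) ⇔ π ∈ goods P n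
  same = mk⇔ (λ π∈ → let σ , σ∈ , π≡gσ = ∈-map⁻ g π∈
                      in subst (_∈ goods P n) (sym π≡gσ) (∈-goods .from (g-good (∈-goods .to σ∈))))
             (λ π∈ → let σ , good , gσ≡π = g-onto (∈-goods .to π∈)
                      in subst (_∈ map g (goods Q m)) gσ≡π (∈-map⁺ g (∈-goods .from good)))

countOP-cong : ∀ {P Q n} → (∀ {π} → IsOverpartitionOf n π → T (P π) ⇔ T (Q π)) → countOP P n ≡ countOP Q n
countOP-cong P⇔Q = countOP-bijection (λ π → π) (λ eq → eq)
  (λ (v , p) → v , P⇔Q v .to p) (λ {π} (v , q) → π , (v , P⇔Q v .from q) , refl)

countOP-none : ∀ {P n} → (∀ {π} → IsOverpartitionOf n π → ¬ T (P π)) → countOP P n ≡ 0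
countOP-none {P} {n} none = cong length (filter-none (T? ∘ isGood P n) (All.universal excluded (candidates n)))
  where
  excluded : ∀ π → ¬ T (isGood P n π)
  excluded π t = let v , p = T-∧ .to t in none (T-isOverpartitionOf .to v) p

countOP-split : ∀ (P R : Overpartition → Bool) n →
  countOP P n ≡ countOP (λ π → P π ∧ R π) n + countOP (λ π → P π ∧ not (R π)) n
countOP-split P R n = split (candidates n)
  where
  split : ∀ πs → length (filterᵇ (λ π → isOverpartitionOf n π ∧ P π) πs)
                 ≡ length (filterᵇ (λ π → isOverpartitionOf n π ∧ (P π ∧ R π)) πs)
                   + length (filterᵇ (λ π → isOverpartitionOf n π ∧ (P π ∧ not (R π))) πs)
  split []       = refl
  split (π ∷ πs) with isOverpartitionOf n π | P π | R π
  ... | false | _     | _     = split πs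
  ... | true  | false | _     = split πs
  ... | true  | true  | true  = cong suc (split πs)
  ... | true  | true  | false = trans (cong suc (split πs)) (sym (+-suc _ _))

countOP-appendPlain : ∀ {P Q : Overpartition → Bool} {m y} → 1 ≤ m →
  (∀ {ov nov} → Good Q y (ov , nov) → All (m ≤_) nov × T (P (ov , nov ∷ʳ m))) →
  (∀ {ov nov} → Good P (m + y) (ov , nov) → ∃[ rest ] nov ≡ rest ∷ʳ m × T (Q (ov , rest))) →
  countOP Q y ≡ countOP P (m + y)
countOP-appendPlain {P} {Q} {m} {y} 1≤m forward backward =
  countOP-bijection appendPlain injective good onto
  where
  appendPlain : Overpartition → Overpartition
  appendPlain (ov , nov) = ov , nov ∷ʳ m
  injective : ∀ {σ τ} → appendPlain σ ≡ appendPlain τ → σ ≡ τ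
  injective {_ , nov} {_ , nov′} eq = cong₂ _,_ (cong proj₁ eq) (∷ʳ-injectiveˡ nov nov′ (cong proj₂ eq))
  good : ∀ {σ} → Good Q y σ → Good P (m + y) (appendPlain σ)
  good (v , q) = let nov≥m , p = forward (v , q) in append-plain v 1≤m nov≥m , p
  onto : ∀ {π} → Good P (m + y) π → ∃[ σ ] Good Q y σ × appendPlain σ ≡ π
  onto {ov , _} (v , p) with rest , refl , q ← backward (v , p) = (ov , rest) , (remove-plain v , q) , refl

countOP-appendOverlined : ∀ {P Q : Overpartition → Bool} {m y} → 1 ≤ m →
  (∀ {ov nov} → Good Q y (ov , nov) → All (m <_) ov × T (P (ov ∷ʳ m , nov))) →
  (∀ {ov nov} → Good P (m + y) (ov , nov) → ∃[ rest ] ov ≡ rest ∷ʳ m × T (Q (rest , nov))) →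
  countOP Q y ≡ countOP P (m + y)
countOP-appendOverlined {P} {Q} {m} {y} 1≤m forward backward =
  countOP-bijection appendOverlined injective good onto
  where
  appendOverlined : Overpartition → Overpartition
  appendOverlined (ov , nov) = ov ∷ʳ m , nov
  injective : ∀ {σ τ} → appendOverlined σ ≡ appendOverlined τ → σ ≡ τ
  injective {ov , _} {ov′ , _} eq = cong₂ _,_ (∷ʳ-injectiveˡ ov ov′ (cong proj₁ eq)) (cong proj₂ eq)
  good : ∀ {σ} → Good Q y σ → Good P (m + y) (appendOverlined σ)
  good (v , q) = let ov>m , p = forward (v , q) in append-overlined v 1≤m ov>m , p
  onto : ∀ {π} → Good P (m + y) π → ∃[ σ ] Good Q y σ × appendOverlined σ ≡ π
  onto {_ , nov} (v , p) with rest , refl , q ← backward (v , p) = (rest , nov) , (remove-overlined v , q) , refl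

-- Overpartitions into restricted parts

allParts : (ℕ → Bool) → Overpartition → Bool
allParts t π = allL t (parts π)

pbarIn : (ℕ → Bool) → ℕ → ℕ
pbarIn t = countOP (allParts t)

_above_ : (ℕ → Bool) → ℕ → ℕ → Bool
(t above m) p = t p ∧ (m <ᵇ p)

plainAbove : ℕ → Overpartition → Bool
plainAbove m π = allL (m <ᵇ_) (proj₂ π)

overlinedAbove : ℕ → Overpartition → Bool
overlinedAbove m π = allL (m <ᵇ_) (proj₁ π)

T-allParts : ∀ {t} ov nov → T (allParts t (ov , nov)) ⇔ (All (T ∘ t) ov × All (T ∘ t) nov)
T-allParts ov nov =
  mk⇔ (All.++⁻ ov ∘ T-allL (ov ++ nov) .to) (λ (tov , tnov) → T-allL (ov ++ nov) .from (All.++⁺ tov tnov))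

T-above : ∀ t {m} p → T ((t above m) p) ⇔ (T (t p) × m < p)
T-above t {m} p = mk⇔ (λ tp → let t-p , m<p = T-∧ .to tp in t-p , <ᵇ⇒< m p m<p)
                      (λ (t-p , m<p) → T-∧ .from (t-p , <⇒<ᵇ m<p))

All-above : ∀ t m {xs} → All (T ∘ (t above m)) xs ⇔ (All (T ∘ t) xs × All (m <_) xs)
All-above t m = mk⇔ (All.unzip ∘ All.map (λ {p} → T-above t p .to)) (All.map (λ {p} → T-above t p .from) ∘ All.zip)

pbarIn-cong : ∀ {t t′} n → (∀ {p} → 1 ≤ p → T (t p) ⇔ T (t′ p)) → pbarIn t n ≡ pbarIn t′ n
pbarIn-cong {t} {t′} n t⇔t′ = countOP-cong {allParts t} {allParts t′} {n} λ {π} v → mk⇔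
  (λ q → T-allL (parts π) .from
           (All.zipWith (λ (1≤p , t-p) → t⇔t′ 1≤p .to t-p) (parts-positive v , T-allL (parts π) .to q)))
  (λ q → T-allL (parts π) .from
           (All.zipWith (λ (1≤p , t-p) → t⇔t′ 1≤p .from t-p) (parts-positive v , T-allL (parts π) .to q)))

pbarIn-vanish : ∀ {t x} → 1 ≤ x → (∀ {p} → T (t p) → x < p) → pbarIn t x ≡ 0
pbarIn-vanish {t} {x} 1≤x t⇒>x = countOP-none {allParts t} {x} λ {π} v q →
  <⇒≢ 1≤x (sym (All>⇒sum≡⇒≡0 (parts π) (All.map t⇒>x (T-allL (parts π) .to q)) (sum-parts v)))

-- Every part allowed by t is at least m, so plainAbove m and overlinedAbove m say that
-- m is not a plain, respectively overlined, part.
module LeastPart (t : ℕ → Bool) {m} (1≤m : 1 ≤ m) (t-m : T (t m)) (least : ∀ {p} → T (t p) → m ≤ p) where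

  pbarIn-withPlain : ∀ y → countOP (λ π → allParts t π ∧ not (plainAbove m π)) (m + y) ≡ pbarIn t y
  pbarIn-withPlain y = sym (countOP-appendPlain 1≤m forward backward)
    where
    forward : ∀ {ov nov} → Good (allParts t) y (ov , nov) →
      All (m ≤_) nov × T (allParts t (ov , nov ∷ʳ m) ∧ not (plainAbove m (ov , nov ∷ʳ m)))
    forward {ov} {nov} (_ , q) =
      let tov , tnov = T-allParts ov nov .to q
      in All.map least tnov ,
         T-∧ .from (T-allParts ov (nov ∷ʳ m) .from (tov , All.∷ʳ⁺ tnov t-m) , T-not .from (¬allAbove-∷ʳ nov))
    backward : ∀ {ov nov} → Good (λ π → allParts t π ∧ not (plainAbove m π)) (m + y) (ov , nov) →
      ∃[ rest ] nov ≡ rest ∷ʳ m × T (allParts t (ov , rest))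
    backward {ov} {nov} (v , p) with q , ¬above ← T-∧ .to p
      with tov , tnov ← T-allParts ov nov .to q
      with rest , refl ← Linked-≥-last (plain-nonincreasing v) (¬allAbove⇒∈ (All.map least tnov) (T-not .to ¬above))
                                       (All.map least tnov)
      = rest , refl , T-allParts ov rest .from (tov , proj₁ (All.∷ʳ⁻ tnov))

  pbarIn-withOverlined : ∀ y →
    countOP (λ π → (allParts t π ∧ plainAbove m π) ∧ not (overlinedAbove m π)) (m + y) ≡ pbarIn (t above m) y
  pbarIn-withOverlined y = sym (countOP-appendOverlined 1≤m forward backward)
    where
    forward : ∀ {ov nov} → Good (allParts (t above m)) y (ov , nov) →
      All (m <_) ov ×
      T ((allParts t (ov ∷ʳ m , nov) ∧ plainAbove m (ov ∷ʳ m , nov)) ∧ not (overlinedAbove m (ov ∷ʳ m , nov)))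
    forward {ov} {nov} (_ , q) =
      let aov , anov = T-allParts ov nov .to q
          tov , ov>m = All-above t m .to aov
          tnov , nov>m = All-above t m .to anov
      in ov>m , T-∧ .from (T-∧ .from (T-allParts (ov ∷ʳ m) nov .from (All.∷ʳ⁺ tov t-m , tnov) ,
                                      T-allAbove nov .from nov>m) ,
                           T-not .from (¬allAbove-∷ʳ ov))
    backward : ∀ {ov nov} →
      Good (λ π → (allParts t π ∧ plainAbove m π) ∧ not (overlinedAbove m π)) (m + y) (ov , nov) →
      ∃[ rest ] ov ≡ rest ∷ʳ m × T (allParts (t above m) (rest , nov))
    backward {ov} {nov} (v , p) with q , ¬above ← T-∧ .to p
      with tq , nov-above ← T-∧ .to q
      with tov , tnov ← T-allParts ov nov .to tq
      with rest , refl ← Linked-≥-last (Linked.map <⇒≤ (overlined-decreasing v))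
                                       (¬allAbove⇒∈ (All.map least tov) (T-not .to ¬above)) (All.map least tov)
      = let rest>m = Linked-∷ʳ⇒All (λ b<a c<b → <-trans c<b b<a) rest (overlined-decreasing v)
        in rest , refl , T-allParts rest nov .from (All-above t m .from (proj₁ (All.∷ʳ⁻ tov) , rest>m) ,
                                                    All-above t m .from (tnov , T-allAbove nov .to nov-above))

  pbarIn-withoutPart : ∀ x →
    countOP (λ π → (allParts t π ∧ plainAbove m π) ∧ overlinedAbove m π) x ≡ pbarIn (t above m) x
  pbarIn-withoutPart x = countOP-cong equivalent
    where
    equivalent : ∀ {π} → IsOverpartitionOf x π →
      T ((allParts t π ∧ plainAbove m π) ∧ overlinedAbove m π) ⇔ T (allParts (t above m) π)
    equivalent {ov , nov} _ = mk⇔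
      (λ p → let q , ov>m = T-∧ .to p; tq , nov>m = T-∧ .to q; tov , tnov = T-allParts ov nov .to tq
             in T-allParts ov nov .from (All-above t m .from (tov , T-allAbove ov .to ov>m) ,
                                         All-above t m .from (tnov , T-allAbove nov .to nov>m)))
      (λ q → let aov , anov = T-allParts ov nov .to q
                 tov , ov>m = All-above t m .to aov
                 tnov , nov>m = All-above t m .to anov
             in T-∧ .from (T-∧ .from (T-allParts ov nov .from (tov , tnov) , T-allAbove nov .from nov>m) ,
                           T-allAbove ov .from ov>m))

  countOP-plainAbove : ∀ y →
    countOP (λ π → allParts t π ∧ plainAbove m π) (m + y) ≡ pbarIn (t above m) (m + y) + pbarIn (t above m) y
  countOP-plainAbove y = trans (countOP-split _ (overlinedAbove m) (m + y))
                               (cong₂ _+_ (pbarIn-withoutPart (m + y)) (pbarIn-withOverlined y))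

  pbarIn-recurrence : ∀ y → pbarIn t (m + y) ≡ (pbarIn (t above m) (m + y) + pbarIn (t above m) y) + pbarIn t y
  pbarIn-recurrence y = trans (countOP-split (allParts t) (plainAbove m) (m + y))
                              (cong₂ _+_ (countOP-plainAbove y) (pbarIn-withPlain y))

parity-+2 : ∀ p → parity (2 + p) ≡ parity p
parity-+2 p = trans (cong parity (+-comm 2 p)) ([m+n]%n≡m%n p 2)

parity-01 : ∀ p → parity p ≡ 0 ⊎ parity p ≡ 1
parity-01 zero          = inj₁ refl
parity-01 (suc zero)    = inj₂ refl
parity-01 (suc (suc p)) rewrite parity-+2 p = parity-01 p

parity-suc : ∀ p → parity (suc p) ≢ parity p
parity-suc zero          ()
parity-suc (suc zero)    ()
parity-suc (suc (suc p)) rewrite parity-+2 (suc p) | parity-+2 p = parity-suc p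

oppositeParity : ℕ → ℕ → Bool
oppositeParity s p = parity p ≠ᵇ parity s

pbar-opp : ℕ → ℕ → ℕ
pbar-opp s = pbarIn (oppositeParity s above s)

pbar-opp-recurrence : ∀ s y →
  pbar-opp s (suc s + y) ≡ (pbar-opp (2 + s) (suc s + y) + pbar-opp (2 + s) y) + pbar-opp s y
pbar-opp-recurrence s y = begin
  pbar-opp s (suc s + y)
    ≡⟨ pbarIn-recurrence y ⟩
  (pbarIn (t above suc s) (suc s + y) + pbarIn (t above suc s) y) + pbar-opp s y
    ≡⟨ cong (_+ pbar-opp s y) (cong₂ _+_ (pbarIn-cong (suc s + y) same) (pbarIn-cong y same)) ⟩
  (pbar-opp (2 + s) (suc s + y) + pbar-opp (2 + s) y) + pbar-opp s y
    ∎
  where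
  open ≡-Reasoning
  t = oppositeParity s above s
  open LeastPart t {suc s} (s≤s z≤n) (T-above (oppositeParity s) (suc s) .from (T-≠ᵇ .from (parity-suc s) , n<1+n s))
                 (λ {p} → proj₂ ∘ T-above (oppositeParity s) p .to)
  same : ∀ {p} → 1 ≤ p → T ((t above suc s) p) ⇔ T ((oppositeParity (2 + s) above (2 + s)) p)
  same {p} _ = mk⇔
    (λ tp → let t-p , s+1<p = T-above t p .to tp; opp , _ = T-above (oppositeParity s) p .to t-p
                opp′ = subst (parity p ≢_) (sym (parity-+2 s)) (T-≠ᵇ .to opp)
            in T-above (oppositeParity (2 + s)) p .from
                 (T-≠ᵇ .from opp′ , ≤∧≢⇒< s+1<p (λ s+2≡p → opp′ (cong parity (sym s+2≡p)))))
    (λ tp → let opp , s+2<p = T-above (oppositeParity (2 + s)) p .to tp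
                opp′ = subst (parity p ≢_) (parity-+2 s) (T-≠ᵇ .to opp)
                s+1<p = <-trans (n<1+n (suc s)) s+2<p
            in T-above t p .from (T-above (oppositeParity s) p .from (T-≠ᵇ .from opp′ , <-trans (n<1+n s) s+1<p) , s+1<p))

pbar-opp-vanish : ∀ {s x} → 1 ≤ x → x ≤ s → pbar-opp s x ≡ 0
pbar-opp-vanish {s} 1≤x x≤s =
  pbarIn-vanish 1≤x (λ {p} tp → ≤-<-trans x≤s (proj₂ (T-above (oppositeParity s) p .to tp)))

-- The smallest plain part

-- 0 when there is no plain part, a case that spt1oCond rejects.
smallestPlain : Overpartition → ℕ
smallestPlain (_ , nov) with reverse nov
... | []    = 0
... | s ∷ _ = s

sptAt : ℕ → Overpartition → Bool
sptAt s π = (smallestPlain π ≡ᵇ s) ∧ spt1oCond π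

sptFrom : ℕ → Overpartition → Bool
sptFrom k π = (k ≤ᵇ smallestPlain π) ∧ spt1oCond π

smallestPlain-∷ʳ : ∀ ov rest s → smallestPlain (ov , rest ∷ʳ s) ≡ s
smallestPlain-∷ʳ ov rest s rewrite reverse-++ rest [ s ] = refl

spt1oCond-∷ʳ : ∀ ov rest s → spt1oCond (ov , rest ∷ʳ s) ≡
  (occurrences s (ov ++ rest ∷ʳ s) ≡ᵇ 1) ∧ allL (s <ᵇ_) ov ∧ allL (oppositeParity s) (ov ++ reverse rest)
spt1oCond-∷ʳ ov rest s rewrite reverse-++ rest [ s ] = refl

T-spt1oCond-∷ʳ : ∀ {s} ov rest → All (s ≤_) rest →
  T (spt1oCond (ov , rest ∷ʳ s)) ⇔ All (T ∘ (oppositeParity s above s)) (ov ++ rest)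
T-spt1oCond-∷ʳ {s} ov rest rest≥s rewrite spt1oCond-∷ʳ ov rest s = mk⇔ to′ from′
  where
  once = occurrences s (ov ++ rest ∷ʳ s) ≡ᵇ 1
  reorder : ov ++ reverse rest ↭ ov ++ rest
  reorder = ++⁺ˡ ov (↭-reverse rest)
  to′ : T (once ∧ allL (s <ᵇ_) ov ∧ allL (oppositeParity s) (ov ++ reverse rest)) →
        All (T ∘ (oppositeParity s above s)) (ov ++ rest)
  to′ t =
    let _ , t′ = T-∧ {once} .to t; ov>s , opp = T-∧ .to t′
        opp-ov , opp-rest = All.++⁻ ov (All-resp-↭ reorder (T-allL (ov ++ reverse rest) .to opp))
        rest>s = All.zipWith (λ (s≤p , opp-p) → ≤∧≢⇒< s≤p (λ s≡p → T-≠ᵇ .to opp-p (cong parity (sym s≡p))))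
                             (rest≥s , opp-rest)
    in All.++⁺ (All-above _ s .from (opp-ov , T-allAbove ov .to ov>s)) (All-above _ s .from (opp-rest , rest>s))
  from′ : All (T ∘ (oppositeParity s above s)) (ov ++ rest) →
          T (once ∧ allL (s <ᵇ_) ov ∧ allL (oppositeParity s) (ov ++ reverse rest))
  from′ a =
    let opp , parts>s = All-above _ s .to a
        exactly-once = trans (cong (occurrences s) (sym (++-assoc ov rest [ s ])))
                             (occurrences-∷ʳ (ov ++ rest) (All.map (λ s<p → ≢-sym (<⇒≢ s<p)) parts>s))
    in T-∧ .from (≡⇒≡ᵇ _ 1 exactly-once ,
                  T-∧ .from (T-allAbove ov .from (proj₁ (All.++⁻ ov parts>s)) ,
                             T-allL (ov ++ reverse rest) .from (All-resp-↭ (↭-sym reorder) opp)))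

sptAt-count : ∀ {s} → 1 ≤ s → ∀ y → countOP (sptAt s) (s + y) ≡ pbar-opp s y
sptAt-count {s} 1≤s y = sym (countOP-appendPlain 1≤s forward backward)
  where
  forward : ∀ {ov nov} → Good (allParts (oppositeParity s above s)) y (ov , nov) →
    All (s ≤_) nov × T (sptAt s (ov , nov ∷ʳ s))
  forward {ov} {nov} (_ , q) =
    let nov≥s = All.map <⇒≤ (proj₂ (All-above _ s .to (proj₂ (T-allParts ov nov .to q))))
    in nov≥s , T-∧ .from (≡⇒≡ᵇ _ s (smallestPlain-∷ʳ ov nov s) ,
                          T-spt1oCond-∷ʳ ov nov nov≥s .from (T-allL (ov ++ nov) .to q))
  backward : ∀ {ov nov} → Good (sptAt s) (s + y) (ov , nov) →
    ∃[ rest ] nov ≡ rest ∷ʳ s × T (allParts (oppositeParity s above s) (ov , rest))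
  backward {ov} {nov} (v , p) with initLast nov
  ... | []          = ⊥-elim (proj₂ (T-∧ {0 ≡ᵇ s} .to p))
  ... | rest ∷ʳ′ s′ with key≡s , spt ← T-∧ {smallestPlain (ov , rest ∷ʳ s′) ≡ᵇ s} .to p
    with refl ← trans (sym (smallestPlain-∷ʳ ov rest s′)) (≡ᵇ⇒≡ _ s key≡s) =
    let rest≥s = Linked-∷ʳ⇒All (λ b≤a c≤b → ≤-trans c≤b b≤a) rest (plain-nonincreasing v)
    in rest , refl , T-allL (ov ++ rest) .from (T-spt1oCond-∷ʳ ov rest rest≥s .to spt)

smallestPlain-bounds : ∀ {x π} → IsOverpartitionOf x π → T (spt1oCond π) →
  1 ≤ smallestPlain π × smallestPlain π ≤ x
smallestPlain-bounds {x} {ov , nov} v spt with initLast nov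
... | []         = ⊥-elim spt
... | rest ∷ʳ′ s rewrite smallestPlain-∷ʳ ov rest s = All.lookup (parts-positive v) s∈ , All.lookup (parts≤n v) s∈
  where
  s∈ : s ∈ ov ++ rest ∷ʳ s
  s∈ = ∈-++⁺ʳ ov (∈-++⁺ʳ rest (here refl))

sptAt-vanish : ∀ {s} x → s ≡ 0 ⊎ x < s → countOP (sptAt s) x ≡ 0
sptAt-vanish {s} x outside = countOP-none {sptAt s} λ {π} v p →
  let key≡s , spt = T-∧ {smallestPlain π ≡ᵇ s} .to p
      1≤key , key≤x = smallestPlain-bounds v spt
  in case outside of λ where
       (inj₁ refl) → <⇒≢ 1≤key (sym (≡ᵇ⇒≡ _ 0 key≡s))
       (inj₂ x<s)  → <⇒≱ x<s (subst (_≤ x) (≡ᵇ⇒≡ _ s key≡s) key≤x)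

sptFrom-vanish : ∀ {k} x → x < k → countOP (sptFrom k) x ≡ 0
sptFrom-vanish {k} x x<k = countOP-none {sptFrom k} λ {π} v p →
  let k≤key , spt = T-∧ {k ≤ᵇ smallestPlain π} .to p
  in <⇒≱ x<k (≤-trans (≤ᵇ⇒≤ k _ k≤key) (proj₂ (smallestPlain-bounds v spt)))

sptFrom-step : ∀ k x → countOP (sptFrom k) x ≡ countOP (sptAt k) x + countOP (sptFrom (suc k)) x
sptFrom-step k x = trans (countOP-split (sptFrom k) (λ π → smallestPlain π ≡ᵇ k) x)
                         (cong₂ _+_ (countOP-cong at-k) (countOP-cong beyond-k))
  where
  at-k : ∀ {π} → IsOverpartitionOf x π → T (sptFrom k π ∧ (smallestPlain π ≡ᵇ k)) ⇔ T (sptAt k π)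
  at-k {π} _ = mk⇔
    (λ p → let q , key≡k = T-∧ {sptFrom k π} .to p
           in T-∧ .from (key≡k , proj₂ (T-∧ {k ≤ᵇ smallestPlain π} .to q)))
    (λ p → let key≡k , spt = T-∧ {smallestPlain π ≡ᵇ k} .to p
           in T-∧ .from (T-∧ .from (≤⇒≤ᵇ (≤-reflexive (sym (≡ᵇ⇒≡ _ k key≡k))) , spt) , key≡k))
  beyond-k : ∀ {π} → IsOverpartitionOf x π → T (sptFrom k π ∧ not (smallestPlain π ≡ᵇ k)) ⇔ T (sptFrom (suc k) π)
  beyond-k {π} _ = mk⇔
    (λ p → let q , key≢k = T-∧ {sptFrom k π} .to p; k≤key , spt = T-∧ {k ≤ᵇ smallestPlain π} .to q
           in T-∧ .from (<⇒<ᵇ (≤∧≢⇒< (≤ᵇ⇒≤ k _ k≤key) (≢-sym (T-≠ᵇ .to key≢k))) , spt))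
    (λ p → let k<key , spt = T-∧ {suc k ≤ᵇ smallestPlain π} .to p; k<key′ = <ᵇ⇒< k _ k<key
           in T-∧ .from (T-∧ .from (≤⇒≤ᵇ (<⇒≤ k<key′) , spt) , T-≠ᵇ .from (≢-sym (<⇒≢ k<key′))))

spt1o≡sptFrom1 : ∀ x → spt1o x ≡ countOP (sptFrom 1) x
spt1o≡sptFrom1 x = trans (sptFrom-step 0 x) (cong (_+ countOP (sptFrom 1) x) (sptAt-vanish x (inj₁ refl)))

pbar-opp-step : ∀ L {k} → 1 ≤ k →
  pbar-opp k (suc L) ≡ (pbar-opp (2 + k) (suc L) + countOP (sptAt (2 + k)) (2 + L)) + countOP (sptAt k) L
pbar-opp-step L {k} 1≤k with k ≤? L
... | yes k≤L with y , refl ← m≤n⇒∃[o]m+o≡n k≤L = begin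
  pbar-opp k (suc k + y)
    ≡⟨ pbar-opp-recurrence k y ⟩
  (pbar-opp (2 + k) (suc k + y) + pbar-opp (2 + k) y) + pbar-opp k y
    ≡⟨ cong₂ (λ a b → (pbar-opp (2 + k) (suc k + y) + a) + b) (sptAt-count (s≤s z≤n) y) (sptAt-count 1≤k y) ⟨
  (pbar-opp (2 + k) (suc k + y) + countOP (sptAt (2 + k)) (2 + k + y)) + countOP (sptAt k) (k + y)
    ∎
  where open ≡-Reasoning
... | no k≰L = trans (pbar-opp-vanish (s≤s z≤n) L<k)
  (sym (cong₂ _+_ (cong₂ _+_ (pbar-opp-vanish (s≤s z≤n) (≤-trans L<k (m≤n+m k 2)))
                             (sptAt-vanish (2 + L) (inj₂ (s≤s (s≤s L<k)))))
                  (sptAt-vanish L (inj₂ L<k))))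
  where L<k = ≰⇒> k≰L

downward-induction : ∀ {ℓ} (P : ℕ → Set ℓ) K → (∀ i → P (K + i)) → (∀ j → P (suc j) → P j) → ∀ j → P j
downward-induction P zero    base step = base
downward-induction P (suc K) base step = downward-induction P K (λ i → step (K + i) (base i)) step

-- The telescoped form of pbar-opp-step; every term vanishes once j ≥ L + 2.
sptFrom-telescope : ∀ L j →
  countOP (sptFrom (suc j)) (2 + L) + countOP (sptFrom (suc j)) L ≡
  ((countOP (sptAt (suc j)) (2 + L) + countOP (sptAt (2 + j)) (2 + L)) + pbar-opp (suc j) (suc L))
    + pbar-opp (2 + j) (suc L)
sptFrom-telescope L = downward-induction Telescoped (2 + L) base step
  where
  Tn Tl Rn Rl Y : ℕ → ℕ
  Tn s = countOP (sptAt s) (2 + L)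
  Tl s = countOP (sptAt s) L
  Rn k = countOP (sptFrom k) (2 + L)
  Rl k = countOP (sptFrom k) L
  Y  k = pbar-opp k (suc L)
  Telescoped : ℕ → Set
  Telescoped j = Rn (suc j) + Rl (suc j) ≡ ((Tn (suc j) + Tn (2 + j)) + Y (suc j)) + Y (2 + j)
  base : ∀ i → Telescoped (2 + L + i)
  base i = trans (cong₂ _+_ (sptFrom-vanish (2 + L) n<k) (sptFrom-vanish L L<k))
    (sym (cong₂ _+_ (cong₂ _+_ (cong₂ _+_ (sptAt-vanish (2 + L) (inj₂ n<k))
                                          (sptAt-vanish (2 + L) (inj₂ (m<n⇒m<1+n n<k))))
                               (pbar-opp-vanish (s≤s z≤n) L<k))
                    (pbar-opp-vanish (s≤s z≤n) (m<n⇒m<1+n L<k))))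
    where
    n<k : 2 + L < suc (2 + L + i)
    n<k = s≤s (m≤m+n (2 + L) i)
    L<k : L < suc (2 + L + i)
    L<k = ≤-<-trans (m≤n+m L 2) n<k
  step : ∀ j → Telescoped (suc j) → Telescoped j
  step j ih = begin
    Rn k + Rl k
      ≡⟨ cong₂ _+_ (sptFrom-step k (2 + L)) (sptFrom-step k L) ⟩
    (Tn k + Rn (suc k)) + (Tl k + Rl (suc k))
      ≡⟨ interchange (Tn k) (Rn (suc k)) (Tl k) (Rl (suc k)) ⟩
    (Tn k + Tl k) + (Rn (suc k) + Rl (suc k))
      ≡⟨ cong ((Tn k + Tl k) +_) ih ⟩
    (Tn k + Tl k) + (((Tn (suc k) + Tn (2 + k)) + Y (suc k)) + Y (2 + k))
      ≡⟨ regroup (Tn k) (Tl k) (Tn (suc k)) (Tn (2 + k)) (Y (suc k)) (Y (2 + k)) ⟩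
    ((Tn k + Tn (suc k)) + ((Y (2 + k) + Tn (2 + k)) + Tl k)) + Y (suc k)
      ≡⟨ cong (λ z → ((Tn k + Tn (suc k)) + z) + Y (suc k)) (pbar-opp-step L (s≤s z≤n)) ⟨
    ((Tn k + Tn (suc k)) + Y k) + Y (suc k)
      ∎
    where
    open ≡-Reasoning
    k = suc j
    interchange : ∀ a b c d → (a + b) + (c + d) ≡ (a + c) + (b + d)
    interchange = solve-∀
    regroup : ∀ a b c d e f → (a + b) + (((c + d) + e) + f) ≡ ((a + c) + ((f + d) + b)) + e
    regroup = solve-∀

pbar-e≡pbar-opp1 : ∀ x → pbar-e x ≡ pbar-opp 1 x
pbar-e≡pbar-opp1 x = pbarIn-cong x λ {p} 1≤p → mk⇔
  (λ even → let parity≡0 = ≡ᵇ⇒≡ (parity p) 0 even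
            in T-above (oppositeParity 1) p .from
                 (T-≠ᵇ .from (λ parity≡1 → 0≢1+n (trans (sym parity≡0) parity≡1)) ,
                  ≤∧≢⇒< 1≤p (λ 1≡p → 0≢1+n (trans (sym parity≡0) (cong parity (sym 1≡p))))))
  (λ opp → case parity-01 p of λ where
     (inj₁ parity≡0) → ≡⇒≡ᵇ (parity p) 0 parity≡0
     (inj₂ parity≡1) → ⊥-elim (T-≠ᵇ .to (proj₁ (T-above (oppositeParity 1) p .to opp)) parity≡1))

pbar-oex≡ : ∀ y → pbar-oex (suc y) ≡ pbar-opp 2 (suc y) + pbar-opp 2 y
pbar-oex≡ y = begin
  pbar-oex (suc y)                                      ≡⟨ countOP-plainAbove y ⟩
  pbarIn (odd above 1) (suc y) + pbarIn (odd above 1) y ≡⟨ cong₂ _+_ (pbarIn-cong (suc y) same) (pbarIn-cong y same) ⟩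
  pbar-opp 2 (suc y) + pbar-opp 2 y                     ∎
  where
  open ≡-Reasoning
  odd : ℕ → Bool
  odd p = parity p ≡ᵇ 1
  odd⇒≥1 : ∀ {p} → T (odd p) → 1 ≤ p
  odd⇒≥1 {suc p} _ = s≤s z≤n
  open LeastPart odd {1} (s≤s z≤n) _ odd⇒≥1
  same : ∀ {p} → 1 ≤ p → T ((odd above 1) p) ⇔ T ((oppositeParity 2 above 2) p)
  same {p} _ = mk⇔
    (λ tp → let is-odd , 1<p = T-above odd p .to tp; parity≡1 = ≡ᵇ⇒≡ (parity p) 1 is-odd
            in T-above (oppositeParity 2) p .from
                 (T-≠ᵇ .from (λ parity≡0 → 0≢1+n (trans (sym parity≡0) parity≡1)) ,
                  ≤∧≢⇒< 1<p (λ 2≡p → 0≢1+n (trans (cong parity 2≡p) parity≡1))))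
    (λ tp → let opp , 2<p = T-above (oppositeParity 2) p .to tp
                is-odd = case parity-01 p of λ where
                  (inj₁ parity≡0) → ⊥-elim (T-≠ᵇ .to opp parity≡0)
                  (inj₂ parity≡1) → ≡⇒≡ᵇ (parity p) 1 parity≡1
            in T-above odd p .from (is-odd , <-trans (n<1+n 1) 2<p))

spt1o-identity : ∀ L → spt1o (2 + L) + spt1o L ≡ 2 * pbar-e (suc L) + pbar-oex (suc L)
spt1o-identity L = begin
  spt1o (2 + L) + spt1o L
    ≡⟨ cong₂ _+_ (spt1o≡sptFrom1 (2 + L)) (spt1o≡sptFrom1 L) ⟩
  countOP (sptFrom 1) (2 + L) + countOP (sptFrom 1) L
    ≡⟨ sptFrom-telescope L 0 ⟩
  ((countOP (sptAt 1) (2 + L) + countOP (sptAt 2) (2 + L)) + pbar-opp 1 (suc L)) + pbar-opp 2 (suc L)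
    ≡⟨ cong₂ (λ a b → ((a + b) + pbar-opp 1 (suc L)) + pbar-opp 2 (suc L))
             (sptAt-count (s≤s z≤n) (suc L)) (sptAt-count (s≤s z≤n) L) ⟩
  ((pbar-opp 1 (suc L) + pbar-opp 2 L) + pbar-opp 1 (suc L)) + pbar-opp 2 (suc L)
    ≡⟨ regroup (pbar-opp 1 (suc L)) (pbar-opp 2 (suc L)) (pbar-opp 2 L) ⟩
  2 * pbar-opp 1 (suc L) + (pbar-opp 2 (suc L) + pbar-opp 2 L)
    ≡⟨ cong₂ (λ a b → 2 * a + b) (pbar-e≡pbar-opp1 (suc L)) (pbar-oex≡ L) ⟨
  2 * pbar-e (suc L) + pbar-oex (suc L)
    ∎
  where
  open ≡-Reasoning
  regroup : ∀ a b c → ((a + c) + a) + b ≡ 2 * a + (b + c)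
  regroup = solve-∀

corollary4p2 : (n : ℕ) → 2 < n →
    spt1o n + spt1o (n ∸ 2) ≡ 2 * pbar-e (n ∸ 1) + pbar-oex (n ∸ 1)
corollary4p2 (suc (suc (suc l))) _ = spt1o-identity (suc l)
corollary4p2 (suc (suc zero))    (s≤s (s≤s ()))
corollary4p2 (suc zero)          (s≤s ())
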